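{- Let $t\ge1$ be an integer such that a $(4t-1,2t-1,t-1)$ skew-Hadamard design exists. Then for every integer $m\ge2$ there exists a $(2t-1)$-resolvable semi-regular (II) self-dual rectangular design with parameters $v=b=m(4t-1)$, $r=k=m(2t-1)$, $\lambda_1=m(t-1)$, $\lambda_2=(m-2)(2t-1)$, $\lambda_3=m(t-1)+1$, $m$, $n=4t-1$.
   Context: A $(4t-1,2t-1,t-1)$ skew-Hadamard design is a symmetric design on $4t-1$ treatments with blocks of size $2t-1$, any two treatments together in $t-1$ blocks, whose incidence matrix $N$ satisfies $N+N^T=J-I$. A rectangular design (RD) with parameters $v=mn,b,r,k,\lambda_1,\lambda_2,\lambda_3,m,n$ has its treatments arranged in an $m\times n$ array, $b$ blocks of size $k$, replication $r$, and any two distinct treatments occur together in $\lambda_1$ blocks if in the same row, $\lambda_2$ if in the same column, $\lambda_3$ otherwise. It is self-dual if the design with transposed incidence matrix is an RD with the same parameters. It is semi-regular (II) if $\theta_2=r-\lambda_2+(n-1)(\lambda_1-\lambda_3)=0$ while $\theta_1=r-\lambda_1+(m-1)(\lambda_2-\lambda_3)>0$ and $\theta_3=r-\lambda_1-\lambda_2+\lambda_3>0$. A design is $\alpha$-resolvable if its blocks can be partitioned into classes such that each treatment occurs in exactly $\alpha$ blocks of each class. -}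

module Defs where

open import Data.Nat using (ℕ; zero; suc; _+_; _*_; _∸_; _>_)
open import Data.Integer as ℤ using (ℤ; +_)
open import Data.Bool using (Bool; true; false; _∧_; if_then_else_)
open import Data.Fin using (Fin; zero; suc)
open import Data.Product using (_×_; _,_; Σ; ∃; proj₁; proj₂)
open import Relation.Binary.PropositionalEquality using (_≡_; _≢_)
open import Relation.Nullary.Decidable using (⌊_⌋)
open import Function.Bundles using (_↔_; Inverse)

count : ∀ {n} → (Fin n → Bool) → ℕ
count {zero}  p = 0
count {suc n} p = (if p zero then 1 else 0) + count (λ j → p (suc j))

-- a (binary) design on v treatments and b blocks, given by its incidence
-- matrix: N i j = true iff treatment i lies in block j
Incidence : ℕ → ℕ → Set
Incidence v b = Fin v → Fin b → Bool

transpose : ∀ {v b} → Incidence v b → Incidence b v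
transpose N j i = N i j

together : ∀ {v b} → Incidence v b → Fin v → Fin v → ℕ
together N i i' = count (λ j → N i j ∧ N i' j)

IsSymmetricDesign : (v k μ : ℕ) → Incidence v v → Set
IsSymmetricDesign v k μ N =
  (∀ j → count (λ i → N i j) ≡ k) ×
  (∀ i i' → i ≢ i' → together N i i' ≡ μ)

-- N + Nᵀ = J - I  (entrywise, for a 0/1 matrix)
IsSkew : ∀ {v} → Incidence v v → Set
IsSkew {v} N =
  (∀ i → N i i ≡ false) ×
  (∀ i j → i ≢ j → (if N i j then 1 else 0) + (if N j i then 1 else 0) ≡ 1)

IsSkewHadamardDesign : (t : ℕ) → Incidence (4 * t ∸ 1) (4 * t ∸ 1) → Set
IsSkewHadamardDesign t N =
  IsSymmetricDesign (4 * t ∸ 1) (2 * t ∸ 1) (t ∸ 1) N × IsSkew N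

IsRectangularDesign : (v b r k l₁ l₂ l₃ m n : ℕ) → Incidence v b → Set
IsRectangularDesign v b r k l₁ l₂ l₃ m n N =
  v ≡ m * n ×
  Σ (Fin v ↔ (Fin m × Fin n)) λ arr →
    let open Inverse arr
        row = λ i → proj₁ (to i)
        col = λ i → proj₂ (to i)
    in
    (∀ i → count (λ j → N i j) ≡ r) ×
    (∀ j → count (λ i → N i j) ≡ k) ×
    (∀ i i' → i ≢ i' → row i ≡ row i' → together N i i' ≡ l₁) ×
    (∀ i i' → i ≢ i' → col i ≡ col i' → together N i i' ≡ l₂) ×
    (∀ i i' → row i ≢ row i' → col i ≢ col i' → together N i i' ≡ l₃)

IsSelfDualRD : (v b r k l₁ l₂ l₃ m n : ℕ) → Incidence v b → Set
IsSelfDualRD v b r k l₁ l₂ l₃ m n N =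
  IsRectangularDesign v b r k l₁ l₂ l₃ m n N ×
  IsRectangularDesign b v r k l₁ l₂ l₃ m n (transpose N)

θ₁ θ₂ θ₃ : (r l₁ l₂ l₃ m n : ℕ) → ℤ
θ₁ r l₁ l₂ l₃ m n = (+ r ℤ.- + l₁) ℤ.+ (+ m ℤ.- + 1) ℤ.* (+ l₂ ℤ.- + l₃)
θ₂ r l₁ l₂ l₃ m n = (+ r ℤ.- + l₂) ℤ.+ (+ n ℤ.- + 1) ℤ.* (+ l₁ ℤ.- + l₃)
θ₃ r l₁ l₂ l₃ m n = ((+ r ℤ.- + l₁) ℤ.- + l₂) ℤ.+ + l₃

IsSemiRegularII : (r l₁ l₂ l₃ m n : ℕ) → Set
IsSemiRegularII r l₁ l₂ l₃ m n =
  θ₂ r l₁ l₂ l₃ m n ≡ + 0 ×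
  θ₁ r l₁ l₂ l₃ m n ℤ.> + 0 ×
  θ₃ r l₁ l₂ l₃ m n ℤ.> + 0

IsResolvable : ∀ {v b} → (α : ℕ) → Incidence v b → Set
IsResolvable {v} {b} α N =
  Σ ℕ λ c → Σ (Fin b → Fin c) λ cls →
    ∀ (q : Fin c) (i : Fin v) →
      count (λ j → N i j ∧ ⌊ cls j Data.Fin.≟ q ⌋) ≡ α

-- The blocks are arranged in an m × m array of n × n cells, with the incidence matrix A of the
-- skew-Hadamard design in the diagonal cells and Aᵀ elsewhere. Skewness, A + Aᵀ = J − I, means that
-- for x ≠ z exactly one of A x z, A z x holds; with n = 2k + 1 and k = 2l + 1 this makes Aᵀ a
-- symmetric design with the same parameters and gives A x · Aᵀ y + A y · Aᵀ x = 2l + 1 for x ≠ y.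
-- Summing over the m cells, two treatments in the same array row share m l blocks, two in the same
-- column (m − 2) k (the two cells where A meets Aᵀ contribute nothing), and any other two m l + 1.
-- Transposing the block matrix gives the same construction for Aᵀ, hence self-duality; each column
-- of cells is a resolution class; and θ₁, θ₂, θ₃ are polynomial identities in m and t.

module Submission where

open import Defs
open import Data.Nat using (ℕ; zero; suc; _+_; _*_; _∸_; _≥_; s≤s; z≤n)
open import Data.Nat.Properties
  using (+-0-commutativeMonoid; +-comm; +-assoc; +-identityʳ; *-zeroʳ; +-cancelˡ-≡; +-cancelʳ-≡;
         suc-injective; m+n∸n≡m; *-distribʳ-∸)
open import Data.Nat.Tactic.RingSolver using (solve-∀; solve)
open import Data.Product using (_×_; Σ; _,_; proj₁; proj₂; uncurry)
open import Data.Bool using (Bool; true; false; _∧_; if_then_else_)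
open import Data.Bool.Properties using (∧-comm; ∧-idem; ∧-identityʳ; ∧-zeroʳ)
open import Data.Fin using (Fin; zero; suc; _≟_; _↑ˡ_; _↑ʳ_; combine; remQuot)
open import Data.Fin.Properties using (remQuot-combine; combine-remQuot; *↔×)
import Data.Fin.Properties as Finₚ
open import Data.List using (_∷_; [])
open import Function using (_∘_)
open import Relation.Binary.PropositionalEquality
open import Relation.Nullary using (yes; no; contradiction)
open import Relation.Nullary.Decidable using (⌊_⌋; isYes≗does; dec-true; dec-false)
open import Algebra.Properties.CommutativeMonoid.Sum +-0-commutativeMonoid
  using (sum; sum-syntax; sum-cong-≗; ∑-distrib-+)

open ≡-Reasoning

cong₃ : ∀ {a b c d} {A : Set a} {B : Set b} {C : Set c} {D : Set d} (f : A → B → C → D) {x x′ y y′ z z′} →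
  x ≡ x′ → y ≡ y′ → z ≡ z′ → f x y z ≡ f x′ y′ z′
cong₃ f refl refl refl = refl

⟦_⟧ : Bool → ℕ
⟦ b ⟧ = if b then 1 else 0

≟-refl : ∀ {n} (a : Fin n) → ⌊ a ≟ a ⌋ ≡ true
≟-refl a = trans (isYes≗does (a ≟ a)) (dec-true (a ≟ a) refl)

≟-≢ : ∀ {n} {a b : Fin n} → a ≢ b → ⌊ a ≟ b ⌋ ≡ false
≟-≢ {a = a} {b} a≢b = trans (isYes≗does (a ≟ b)) (dec-false (a ≟ b) a≢b)

count≡∑ : ∀ {n} (p : Fin n → Bool) → count p ≡ ∑[ j < n ] ⟦ p j ⟧
count≡∑ {zero}  p = refl
count≡∑ {suc n} p = cong (⟦ p zero ⟧ +_) (count≡∑ (p ∘ suc))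

count-cong : ∀ {n} {p q : Fin n → Bool} → (∀ j → p j ≡ q j) → count p ≡ count q
count-cong {zero}  e = refl
count-cong {suc n} e = cong₂ _+_ (cong ⟦_⟧ (e zero)) (count-cong (e ∘ suc))

count-false : ∀ n → count {n} (λ _ → false) ≡ 0
count-false zero    = refl
count-false (suc n) = count-false n

count-true : ∀ n → count {n} (λ _ → true) ≡ n
count-true zero    = refl
count-true (suc n) = cong suc (count-true n)

∑-const : ∀ n c → ∑[ i < n ] c ≡ n * c
∑-const zero    c = refl
∑-const (suc n) c = cong (c +_) (∑-const n c)

∑-zero : ∀ {n} (g : Fin n → ℕ) → (∀ z → g z ≡ 0) → sum g ≡ 0
∑-zero {n} g g≡0 = trans (sum-cong-≗ g≡0) (trans (∑-const n 0) (*-zeroʳ n))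

∑-concentrated : ∀ {n} (y : Fin n) (g : Fin n → ℕ) → (∀ z → z ≢ y → g z ≡ 0) → sum g ≡ g y
∑-concentrated zero g g≡0 =
  trans (cong (g zero +_) (∑-zero (g ∘ suc) (λ z → g≡0 (suc z) λ ()))) (+-identityʳ (g zero))
∑-concentrated (suc y) g g≡0 =
  trans (cong (_+ sum (g ∘ suc)) (g≡0 zero λ ()))
        (∑-concentrated y (g ∘ suc) (λ z z≢y → g≡0 (suc z) (z≢y ∘ Finₚ.suc-injective)))

point : ∀ {m} → Fin m → ℕ → Fin m → ℕ
point a v c = if ⌊ c ≟ a ⌋ then v else 0

∑-point : ∀ {m} (a : Fin m) v → sum (point a v) ≡ v
∑-point a v = trans (∑-concentrated a (point a v) (λ c c≢a → cong (if_then v else 0) (≟-≢ c≢a)))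
                    (cong (if_then v else 0) (≟-refl a))

-- Stated without ∸: each of the m − 2 remaining points contributes y.
∑-two-points : ∀ {m} {a b : Fin m} → a ≢ b → (g : Fin m → ℕ) {x y z : ℕ} →
  g a ≡ x → g b ≡ z → (∀ c → c ≢ a → c ≢ b → g c ≡ y) → sum g + (y + y) ≡ m * y + (x + z)
∑-two-points {m} {a} {b} a≢b g {x} {y} {z} ga gb gc = begin
  sum g + (y + y)                                     ≡⟨ cong₂ (λ u v → sum g + (u + v)) (∑-point a y) (∑-point b y) ⟨
  sum g + (sum (point a y) + sum (point b y))         ≡⟨ cong (sum g +_) (∑-distrib-+ (point a y) (point b y)) ⟨
  sum g + ∑[ c < m ] (point a y c + point b y c)      ≡⟨ ∑-distrib-+ g (λ c → point a y c + point b y c) ⟨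
  ∑[ c < m ] (g c + (point a y c + point b y c))      ≡⟨ sum-cong-≗ pointwise ⟩
  ∑[ c < m ] (y + (point a x c + point b z c))        ≡⟨ ∑-distrib-+ (λ _ → y) (λ c → point a x c + point b z c) ⟩
  ∑[ c < m ] y + ∑[ c < m ] (point a x c + point b z c)  ≡⟨ cong₂ _+_ (∑-const m y) (∑-distrib-+ (point a x) (point b z)) ⟩
  m * y + (sum (point a x) + sum (point b z))         ≡⟨ cong₂ (λ u v → m * y + (u + v)) (∑-point a x) (∑-point b z) ⟩
  m * y + (x + z)                                     ∎
  where
  comm₀ : ∀ u v → u + (v + 0) ≡ v + (u + 0)
  comm₀ = solve-∀
  pointwise : ∀ c → g c + (point a y c + point b y c) ≡ y + (point a x c + point b z c)
  pointwise c with c ≟ a | c ≟ b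
  ... | yes refl | yes refl = contradiction refl a≢b
  ... | yes refl | no _     = trans (cong (_+ (y + 0)) ga) (comm₀ x y)
  ... | no _     | yes refl = trans (cong (_+ y) gb) (+-comm z y)
  ... | no c≢a   | no c≢b   = cong (_+ 0) (gc c c≢a c≢b)

∑-↑ : ∀ a b (f : Fin (a + b) → ℕ) → sum f ≡ ∑[ i < a ] f (i ↑ˡ b) + ∑[ j < b ] f (a ↑ʳ j)
∑-↑ zero    b f = refl
∑-↑ (suc a) b f = trans (cong (f zero +_) (∑-↑ a b (f ∘ suc))) (sym (+-assoc (f zero) _ _))

∑-combine : ∀ m n (f : Fin (m * n) → ℕ) → sum f ≡ ∑[ c < m ] ∑[ z < n ] f (combine c z)
∑-combine zero    n f = refl
∑-combine (suc m) n f =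
  trans (∑-↑ n (m * n) f) (cong (∑[ z < n ] f (z ↑ˡ (m * n)) +_) (∑-combine m n (f ∘ (n ↑ʳ_))))

count-remQuot : ∀ m n (p : Fin m × Fin n → Bool) →
  count (λ j → p (remQuot {m} n j)) ≡ ∑[ c < m ] count (λ z → p (c , z))
count-remQuot m n p = begin
  count (λ j → p (remQuot n j))                        ≡⟨ count≡∑ (p ∘ remQuot n) ⟩
  ∑[ j < m * n ] ⟦ p (remQuot n j) ⟧                   ≡⟨ ∑-combine m n _ ⟩
  ∑[ c < m ] ∑[ z < n ] ⟦ p (remQuot n (combine c z)) ⟧ ≡⟨ sum-cong-≗ (λ c → sum-cong-≗ λ z →
                                                            cong (⟦_⟧ ∘ p) (remQuot-combine c z)) ⟩
  ∑[ c < m ] ∑[ z < n ] ⟦ p (c , z) ⟧                   ≡⟨ sum-cong-≗ (λ c → count≡∑ (λ z → p (c , z))) ⟨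
  ∑[ c < m ] count (λ z → p (c , z))                   ∎

infix 7 _·_

_·_ : ∀ {n} → (Fin n → Bool) → (Fin n → Bool) → ℕ
u · v = count (λ z → u z ∧ v z)

·-comm : ∀ {n} (u v : Fin n → Bool) → u · v ≡ v · u
·-comm u v = count-cong (λ z → ∧-comm (u z) (v z))

·-idem : ∀ {n} (u : Fin n → Bool) → u · u ≡ count u
·-idem u = count-cong (∧-idem ∘ u)

·-disjoint : ∀ {n} (u v : Fin n → Bool) → (∀ z → u z ∧ v z ≡ false) → u · v ≡ 0
·-disjoint {n} u v u∧v≡false = trans (count-cong u∧v≡false) (count-false n)

δ : ∀ {n} → Fin n → Fin n → Bool
δ y z = ⌊ z ≟ y ⌋

·-δ : ∀ {n} (u : Fin n → Bool) (y : Fin n) → u · δ y ≡ ⟦ u y ⟧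
·-δ {n} u y = begin
  u · δ y                     ≡⟨ count≡∑ (λ z → u z ∧ δ y z) ⟩
  ∑[ z < n ] ⟦ u z ∧ δ y z ⟧  ≡⟨ ∑-concentrated y _ off ⟩
  ⟦ u y ∧ δ y y ⟧             ≡⟨ cong (λ b → ⟦ u y ∧ b ⟧) (≟-refl y) ⟩
  ⟦ u y ∧ true ⟧              ≡⟨ cong ⟦_⟧ (∧-identityʳ (u y)) ⟩
  ⟦ u y ⟧                     ∎
  where
  off : ∀ z → z ≢ y → ⟦ u z ∧ δ y z ⟧ ≡ 0
  off z z≢y = trans (cong (λ b → ⟦ u z ∧ b ⟧) (≟-≢ z≢y)) (cong ⟦_⟧ (∧-zeroʳ (u z)))

data ExactlyOne : Bool → Bool → Bool → Set where
  first  : ExactlyOne true false false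
  second : ExactlyOne false true false
  third  : ExactlyOne false false true

exactlyOne-disjoint : ∀ {a b e} → ExactlyOne a b e → a ∧ b ≡ false
exactlyOne-disjoint first  = refl
exactlyOne-disjoint second = refl
exactlyOne-disjoint third  = refl

⟦∧⟧-partition : ∀ c {a b e} → ExactlyOne a b e → ⟦ c ∧ a ⟧ + ⟦ c ∧ b ⟧ + ⟦ c ∧ e ⟧ ≡ ⟦ c ⟧
⟦∧⟧-partition true  first  = refl
⟦∧⟧-partition true  second = refl
⟦∧⟧-partition true  third  = refl
⟦∧⟧-partition false _      = refl

·-partition : ∀ {n} (c a b e : Fin n → Bool) → (∀ z → ExactlyOne (a z) (b z) (e z)) →
  c · a + c · b + c · e ≡ count c
·-partition {n} c a b e one = begin
  c · a + c · b + c · e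
    ≡⟨ cong₂ _+_ (cong₂ _+_ (count≡∑ (λ z → c z ∧ a z)) (count≡∑ (λ z → c z ∧ b z))) (count≡∑ (λ z → c z ∧ e z)) ⟩
  ∑[ z < n ] ⟦ c z ∧ a z ⟧ + ∑[ z < n ] ⟦ c z ∧ b z ⟧ + ∑[ z < n ] ⟦ c z ∧ e z ⟧
    ≡⟨ cong (_+ ∑[ z < n ] ⟦ c z ∧ e z ⟧) (∑-distrib-+ (λ z → ⟦ c z ∧ a z ⟧) (λ z → ⟦ c z ∧ b z ⟧)) ⟨
  ∑[ z < n ] (⟦ c z ∧ a z ⟧ + ⟦ c z ∧ b z ⟧) + ∑[ z < n ] ⟦ c z ∧ e z ⟧
    ≡⟨ ∑-distrib-+ (λ z → ⟦ c z ∧ a z ⟧ + ⟦ c z ∧ b z ⟧) (λ z → ⟦ c z ∧ e z ⟧) ⟨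
  ∑[ z < n ] (⟦ c z ∧ a z ⟧ + ⟦ c z ∧ b z ⟧ + ⟦ c z ∧ e z ⟧)
    ≡⟨ sum-cong-≗ (λ z → ⟦∧⟧-partition (c z) (one z)) ⟩
  ∑[ z < n ] ⟦ c z ⟧
    ≡⟨ count≡∑ c ⟨
  count c ∎

IsSkewSymmetricDesign : (n k l : ℕ) → Incidence n n → Set
IsSkewSymmetricDesign n k l A = IsSymmetricDesign n k l A × IsSkew A

exactlyOne-of-two : ∀ a b → ⟦ a ⟧ + ⟦ b ⟧ ≡ 1 → ExactlyOne a b false
exactlyOne-of-two true  true  ()
exactlyOne-of-two true  false _ = first
exactlyOne-of-two false true  _ = second
exactlyOne-of-two false false ()

skew-exactlyOne : ∀ {n} {A : Incidence n n} → IsSkew A → ∀ x z → ExactlyOne (A z x) (A x z) (δ x z)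
skew-exactlyOne {A = A} (diagonal , offDiagonal) x z with z ≟ x
... | yes refl rewrite diagonal z = third
... | no z≢x = exactlyOne-of-two (A z x) (A x z) (offDiagonal z x z≢x)

transpose-isSkew : ∀ {n} {A : Incidence n n} → IsSkew A → IsSkew (transpose A)
transpose-isSkew (diagonal , offDiagonal) = diagonal , λ i j i≢j → offDiagonal j i (≢-sym i≢j)

module SkewSymmetricDesign {n k l : ℕ} (n≡ : n ≡ suc (k + k)) {A : Incidence n n}
                           (design : IsSkewSymmetricDesign n k l A) where

  columnCount : ∀ x → count (transpose A x) ≡ k
  columnCount = proj₁ (proj₁ design)

  rowProduct : ∀ x y → x ≢ y → A x · A y ≡ l
  rowProduct = proj₂ (proj₁ design)

  skew : IsSkew A
  skew = proj₂ design

  exactlyOne : ∀ x z → ExactlyOne (A z x) (A x z) (δ x z)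
  exactlyOne = skew-exactlyOne skew

  column-row-disjoint : ∀ x → transpose A x · A x ≡ 0
  column-row-disjoint x = ·-disjoint (transpose A x) (A x) (λ z → exactlyOne-disjoint (exactlyOne x z))

  rowCount : ∀ x → count (A x) ≡ k
  rowCount x = +-cancelˡ-≡ k _ _ (suc-injective (begin
    suc (k + count (A x))   ≡⟨ +-comm 1 (k + count (A x)) ⟩
    k + count (A x) + 1     ≡⟨ cong₃ (λ c r d → c + r + d) (columnCount x) refl (·-δ (λ _ → true) x) ⟨
    (λ _ → true) · transpose A x + (λ _ → true) · A x + (λ _ → true) · δ x
                            ≡⟨ ·-partition (λ _ → true) (transpose A x) (A x) (δ x) (exactlyOne x) ⟩
    count {n} (λ _ → true)  ≡⟨ count-true n ⟩
    n                       ≡⟨ n≡ ⟩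
    suc (k + k)             ∎))

  row-column-product : ∀ {x y} → x ≢ y → A x · transpose A y + l + ⟦ A x y ⟧ ≡ k
  row-column-product {x} {y} x≢y = begin
    A x · transpose A y + l + ⟦ A x y ⟧
      ≡⟨ cong₃ (λ c r d → c + r + d) refl (rowProduct x y x≢y) (·-δ (A x) y) ⟨
    A x · transpose A y + A x · A y + A x · δ y
      ≡⟨ ·-partition (A x) (transpose A y) (A y) (δ y) (exactlyOne y) ⟩
    count (A x)
      ≡⟨ rowCount x ⟩
    k ∎

  -- Splitting column y along the trichotomy at x expresses k through A x · Aᵀ y and A x y exactly
  -- as row-column-product does, so AᵀA agrees with AAᵀ off the diagonal.
  column-product : ∀ {x y} → x ≢ y → transpose A y · transpose A x ≡ l
  column-product {x} {y} x≢y = +-cancelˡ-≡ X _ _ (+-cancelʳ-≡ ⟦ A x y ⟧ _ _ (begin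
    X + transpose A y · transpose A x + ⟦ A x y ⟧
      ≡⟨ cong (_+ ⟦ A x y ⟧) (+-comm X _) ⟩
    transpose A y · transpose A x + X + ⟦ A x y ⟧
      ≡⟨ cong₃ (λ c r d → c + r + d) refl (·-comm (transpose A y) (A x)) (·-δ (transpose A y) x) ⟨
    transpose A y · transpose A x + transpose A y · A x + transpose A y · δ x
      ≡⟨ ·-partition (transpose A y) (transpose A x) (A x) (δ x) (exactlyOne x) ⟩
    count (transpose A y)
      ≡⟨ columnCount y ⟩
    k
      ≡⟨ row-column-product x≢y ⟨
    X + l + ⟦ A x y ⟧ ∎))
    where
    X = A x · transpose A y

  transpose-isSkewSymmetricDesign : IsSkewSymmetricDesign n k l (transpose A)
  transpose-isSkewSymmetricDesign =
    (rowCount , λ x y x≢y → column-product (≢-sym x≢y)) , transpose-isSkew {A = A} skew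

s+2k≡mk⇒s≡[m∸2]k : ∀ s m k → s + (k + k) ≡ m * k → s ≡ (m ∸ 2) * k
s+2k≡mk⇒s≡[m∸2]k s m k eq = begin
  s                       ≡⟨ m+n∸n≡m s (k + k) ⟨
  s + (k + k) ∸ (k + k)   ≡⟨ cong₂ _∸_ eq (cong (k +_) (sym (+-identityʳ k))) ⟩
  m * k ∸ 2 * k           ≡⟨ *-distribʳ-∸ k m 2 ⟨
  (m ∸ 2) * k             ∎

crossings-sum : ∀ x z l p q → x + l + p ≡ suc (l + l) → z + l + q ≡ suc (l + l) → p + q ≡ 1 →
  x + z ≡ suc (l + l)
crossings-sum x z l p q hx hz p+q≡1 = +-cancelʳ-≡ (suc (l + l)) _ _ (begin
  x + z + suc (l + l)          ≡⟨ cong (λ w → x + z + (w + (l + l))) p+q≡1 ⟨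
  x + z + (p + q + (l + l))    ≡⟨ solve (x ∷ z ∷ l ∷ p ∷ q ∷ []) ⟩
  (x + l + p) + (z + l + q)    ≡⟨ cong₂ _+_ hx hz ⟩
  suc (l + l) + suc (l + l)    ∎)

s+2l≡ml+[2l+1]⇒s≡ml+1 : ∀ s m l → s + (l + l) ≡ m * l + suc (l + l) → s ≡ m * l + 1
s+2l≡ml+[2l+1]⇒s≡ml+1 s m l eq =
  +-cancelʳ-≡ (l + l) s (m * l + 1) (trans eq (solve (m ∷ l ∷ [])))

module BlockMatrix (m : ℕ) {n : ℕ} where

  -- Treatment (a , x) meets the blocks (c , _) in row x of A if a = c and in column x of A otherwise.
  segment : Incidence n n → Fin m → Fin n → Fin m → Fin n → Bool
  segment A a x c = if ⌊ a ≟ c ⌋ then A x else transpose A x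

  block : Incidence n n → Fin m × Fin n → Fin m × Fin n → Bool
  block A (a , x) (c , z) = segment A a x c z

  position : Fin (m * n) → Fin m × Fin n
  position = remQuot n

  blockMatrix : Incidence n n → Incidence (m * n) (m * n)
  blockMatrix A i j = block A (position i) (position j)

  blockProduct : Incidence n n → Fin m × Fin n → Fin m × Fin n → ℕ
  blockProduct A (a , x) (b , y) = ∑[ c < m ] (segment A a x c · segment A b y c)

  block-transpose : ∀ A P Q → block A Q P ≡ block (transpose A) P Q
  block-transpose A (a , x) (c , z) with a ≟ c | c ≟ a
  ... | yes _   | yes _   = refl
  ... | no _    | no _    = refl
  ... | yes a≡c | no c≢a  = contradiction (sym a≡c) c≢a
  ... | no a≢c  | yes c≡a = contradiction (sym c≡a) a≢c

  position-injective : ∀ {i j : Fin (m * n)} → i ≢ j → position i ≢ position j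
  position-injective {i} {j} i≢j eq =
    i≢j (trans (sym (combine-remQuot {m} n i)) (trans (cong (uncurry combine) eq) (combine-remQuot {m} n j)))

  together-blockMatrix : ∀ A i i′ → together (blockMatrix A) i i′ ≡ blockProduct A (position i) (position i′)
  together-blockMatrix A i i′ = count-remQuot m n (λ Q → block A (position i) Q ∧ block A (position i′) Q)

  module _ {k : ℕ} {A : Incidence n n} (rowCount : ∀ x → count (A x) ≡ k)
           (columnCount : ∀ x → count (transpose A x) ≡ k) where

    count-segment : ∀ a x c → count (segment A a x c) ≡ k
    count-segment a x c with a ≟ c
    ... | yes _ = rowCount x
    ... | no _  = columnCount x

    count-blockMatrix : ∀ i → count (blockMatrix A i) ≡ m * k
    count-blockMatrix i = trans (count-remQuot m n (block A (position i)))
      (trans (sum-cong-≗ (count-segment (proj₁ (position i)) (proj₂ (position i)))) (∑-const m k))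

    count-blockMatrix-class : ∀ q i → count (λ j → blockMatrix A i j ∧ ⌊ proj₁ (position j) ≟ q ⌋) ≡ k
    count-blockMatrix-class q i =
      trans (count-remQuot m n (λ Q → block A (a , x) Q ∧ ⌊ proj₁ Q ≟ q ⌋))
            (trans (∑-concentrated q _ other) onClass)
      where
      a = proj₁ (position i)
      x = proj₂ (position i)
      other : ∀ c → c ≢ q → count (λ z → segment A a x c z ∧ ⌊ c ≟ q ⌋) ≡ 0
      other c c≢q rewrite ≟-≢ c≢q = trans (count-cong (λ z → ∧-zeroʳ (segment A a x c z))) (count-false n)
      onClass : count (λ z → segment A a x q z ∧ ⌊ q ≟ q ⌋) ≡ k
      onClass rewrite ≟-refl q = trans (count-cong (λ z → ∧-identityʳ (segment A a x q z))) (count-segment a x q)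

module BlockDesign (m : ℕ) {n k l : ℕ} (n≡ : n ≡ suc (k + k)) (k≡ : k ≡ suc (l + l))
                   {A : Incidence n n} (design : IsSkewSymmetricDesign n k l A) where

  open BlockMatrix m
  open SkewSymmetricDesign n≡ design

  blockProduct-sameRow : ∀ {P Q} → P ≢ Q → proj₁ P ≡ proj₁ Q → blockProduct A P Q ≡ m * l
  blockProduct-sameRow {a , x} {.a , y} P≢Q refl = trans (sum-cong-≗ segmentProduct) (∑-const m l)
    where
    x≢y : x ≢ y
    x≢y x≡y = P≢Q (cong (a ,_) x≡y)
    segmentProduct : ∀ c → segment A a x c · segment A a y c ≡ l
    segmentProduct c with a ≟ c
    ... | yes _ = rowProduct x y x≢y
    ... | no _  = column-product (≢-sym x≢y)

  blockProduct-sameColumn : ∀ {P Q} → P ≢ Q → proj₂ P ≡ proj₂ Q → blockProduct A P Q ≡ (m ∸ 2) * k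
  blockProduct-sameColumn {a , x} {b , .x} P≢Q refl =
    s+2k≡mk⇒s≡[m∸2]k _ m k (trans (∑-two-points a≢b g ga gb gc) (+-identityʳ (m * k)))
    where
    a≢b : a ≢ b
    a≢b a≡b = P≢Q (cong (_, x) a≡b)
    g : Fin m → ℕ
    g c = segment A a x c · segment A b x c
    ga : g a ≡ 0
    ga with a ≟ a | b ≟ a
    ... | yes _   | no _    = trans (·-comm (A x) (transpose A x)) (column-row-disjoint x)
    ... | _       | yes b≡a = contradiction (sym b≡a) a≢b
    ... | no a≢a  | no _    = contradiction refl a≢a
    gb : g b ≡ 0
    gb with a ≟ b | b ≟ b
    ... | no _    | yes _   = column-row-disjoint x
    ... | yes a≡b | _       = contradiction a≡b a≢b
    ... | no _    | no b≢b  = contradiction refl b≢b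
    gc : ∀ c → c ≢ a → c ≢ b → g c ≡ k
    gc c c≢a c≢b with a ≟ c | b ≟ c
    ... | yes a≡c | _       = contradiction (sym a≡c) c≢a
    ... | no _    | yes b≡c = contradiction (sym b≡c) c≢b
    ... | no _    | no _    = trans (·-idem (transpose A x)) (columnCount x)

  blockProduct-otherwise : ∀ {P Q} → proj₁ P ≢ proj₁ Q → proj₂ P ≢ proj₂ Q → blockProduct A P Q ≡ m * l + 1
  blockProduct-otherwise {a , x} {b , y} a≢b x≢y =
    s+2l≡ml+[2l+1]⇒s≡ml+1 _ m l (trans (∑-two-points a≢b g ga gb gc) (cong (m * l +_) crossings))
    where
    g : Fin m → ℕ
    g c = segment A a x c · segment A b y c
    ga : g a ≡ A x · transpose A y
    ga with a ≟ a | b ≟ a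
    ... | yes _   | no _    = refl
    ... | _       | yes b≡a = contradiction (sym b≡a) a≢b
    ... | no a≢a  | no _    = contradiction refl a≢a
    gb : g b ≡ A y · transpose A x
    gb with a ≟ b | b ≟ b
    ... | no _    | yes _   = ·-comm (transpose A x) (A y)
    ... | yes a≡b | _       = contradiction a≡b a≢b
    ... | no _    | no b≢b  = contradiction refl b≢b
    gc : ∀ c → c ≢ a → c ≢ b → g c ≡ l
    gc c c≢a c≢b with a ≟ c | b ≟ c
    ... | yes a≡c | _       = contradiction (sym a≡c) c≢a
    ... | no _    | yes b≡c = contradiction (sym b≡c) c≢b
    ... | no _    | no _    = column-product (≢-sym x≢y)
    crossings : A x · transpose A y + A y · transpose A x ≡ suc (l + l)
    crossings = crossings-sum (A x · transpose A y) (A y · transpose A x) l ⟦ A x y ⟧ ⟦ A y x ⟧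
                  (trans (row-column-product x≢y) k≡) (trans (row-column-product (≢-sym x≢y)) k≡)
                  (proj₂ skew x y x≢y)

  isRectangularDesign : IsRectangularDesign (m * n) (m * n) (m * k) (m * k) (m * l) ((m ∸ 2) * k) (m * l + 1)
                                            m n (blockMatrix A)
  isRectangularDesign =
    refl , *↔× , count-blockMatrix rowCount columnCount , columnCounts ,
    (λ i i′ i≢i′ → trans (together-blockMatrix A i i′) ∘ blockProduct-sameRow (position-injective i≢i′)) ,
    (λ i i′ i≢i′ → trans (together-blockMatrix A i i′) ∘ blockProduct-sameColumn (position-injective i≢i′)) ,
    (λ i i′ rows≢ → trans (together-blockMatrix A i i′) ∘ blockProduct-otherwise rows≢)
    where
    columnCounts : ∀ j → count (λ i → blockMatrix A i j) ≡ m * k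
    columnCounts j = trans (count-cong (block-transpose A (position j) ∘ position))
                           (count-blockMatrix columnCount rowCount j)

  isResolvable : IsResolvable k (blockMatrix A)
  isResolvable = m , proj₁ ∘ position , λ q → count-blockMatrix-class rowCount columnCount q

isRectangularDesign-resp : ∀ {v b r k l₁ l₂ l₃ m n} {N N′ : Incidence v b} → (∀ i j → N i j ≡ N′ i j) →
  IsRectangularDesign v b r k l₁ l₂ l₃ m n N′ → IsRectangularDesign v b r k l₁ l₂ l₃ m n N
isRectangularDesign-resp {N = N} {N′} N≡N′ (v≡ , arr , rows , columns , same₁ , same₂ , other) =
  v≡ , arr , (λ i → trans (count-cong (N≡N′ i)) (rows i)) ,
  (λ j → trans (count-cong (λ i → N≡N′ i j)) (columns j)) ,
  (λ i i′ i≢i′ → trans (together≡ i i′) ∘ same₁ i i′ i≢i′) ,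
  (λ i i′ i≢i′ → trans (together≡ i i′) ∘ same₂ i i′ i≢i′) ,
  (λ i i′ rows≢ → trans (together≡ i i′) ∘ other i i′ rows≢)
  where
  together≡ : ∀ i i′ → together N i i′ ≡ together N′ i i′
  together≡ i i′ = count-cong (λ j → cong₂ _∧_ (N≡N′ i j) (N≡N′ i′ j))

blockMatrix-isSelfDualRD : ∀ m {n k l} (n≡ : n ≡ suc (k + k)) (k≡ : k ≡ suc (l + l)) {A : Incidence n n} →
  IsSkewSymmetricDesign n k l A →
  IsSelfDualRD (m * n) (m * n) (m * k) (m * k) (m * l) ((m ∸ 2) * k) (m * l + 1) m n (BlockMatrix.blockMatrix m A)
blockMatrix-isSelfDualRD m n≡ k≡ {A} design =
  BlockDesign.isRectangularDesign m n≡ k≡ design ,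
  isRectangularDesign-resp (λ i j → block-transpose A (position i) (position j))
    (BlockDesign.isRectangularDesign m n≡ k≡ (SkewSymmetricDesign.transpose-isSkewSymmetricDesign n≡ design))
  where open BlockMatrix m

module _ where
  open import Data.Integer as ℤ using (ℤ; +_; +<+)
  open import Data.Integer.Properties using (pos-*)
  import Data.Integer.Tactic.RingSolver as ℤ-Solver

  positive : ∀ {x} j → x ≡ + suc j → x ℤ.> + 0
  positive j refl = +<+ (s≤s z≤n)

  semiRegularII : ∀ m′ {l k n} → k ≡ suc (l + l) → n ≡ suc (k + k) →
    IsSemiRegularII ((2 + m′) * k) ((2 + m′) * l) (m′ * k) ((2 + m′) * l + 1) (2 + m′) n
  semiRegularII m′ {l} refl refl = θ₂≡0 , positive (m′ + m′ * m′ * suc l) θ₁≡ , positive (k + k) θ₃≡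
    where
    m k : ℕ
    m = 2 + m′
    k = suc (l + l)
    -- + m, + k and + (m * l + 1) are definitionally + 2 ℤ.+ + m′, + 1 ℤ.+ (+ l ℤ.+ + l) and
    -- + (m * l) ℤ.+ + 1, so once the three products are cast each θ is a polynomial identity in m′, l.
    cast : (f : ℤ → ℤ → ℤ → ℤ) →
      f (+ (m * k)) (+ (m * l)) (+ (m′ * k)) ≡ f (+ m ℤ.* + k) (+ m ℤ.* + l) (+ m′ ℤ.* + k)
    cast f = cong₃ f (pos-* m k) (pos-* m l) (pos-* m′ k)
    θ₂-poly : ∀ M L → let m = + 2 ℤ.+ M; k = + 1 ℤ.+ (L ℤ.+ L) in
      (m ℤ.* k ℤ.- M ℤ.* k) ℤ.+ (+ 1 ℤ.+ (k ℤ.+ k) ℤ.- + 1) ℤ.* (m ℤ.* L ℤ.- (m ℤ.* L ℤ.+ + 1)) ≡ + 0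
    θ₂-poly = ℤ-Solver.solve-∀
    θ₁-poly : ∀ M L → let m = + 2 ℤ.+ M; k = + 1 ℤ.+ (L ℤ.+ L) in
      (m ℤ.* k ℤ.- m ℤ.* L) ℤ.+ (m ℤ.- + 1) ℤ.* (M ℤ.* k ℤ.- (m ℤ.* L ℤ.+ + 1))
        ≡ + 1 ℤ.+ (M ℤ.+ M ℤ.* M ℤ.* (+ 1 ℤ.+ L))
    θ₁-poly = ℤ-Solver.solve-∀
    θ₃-poly : ∀ M L → let m = + 2 ℤ.+ M; k = + 1 ℤ.+ (L ℤ.+ L) in
      ((m ℤ.* k ℤ.- m ℤ.* L) ℤ.- M ℤ.* k) ℤ.+ (m ℤ.* L ℤ.+ + 1) ≡ + 1 ℤ.+ (k ℤ.+ k)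
    θ₃-poly = ℤ-Solver.solve-∀
    θ₂≡0 : θ₂ (m * k) (m * l) (m′ * k) (m * l + 1) m (suc (k + k)) ≡ + 0
    θ₂≡0 = trans (cast (λ r l₁ l₂ → (r ℤ.- l₂) ℤ.+ (+ suc (k + k) ℤ.- + 1) ℤ.* (l₁ ℤ.- (l₁ ℤ.+ + 1))))
                 (θ₂-poly (+ m′) (+ l))
    θ₁≡ : θ₁ (m * k) (m * l) (m′ * k) (m * l + 1) m (suc (k + k)) ≡ + suc (m′ + m′ * m′ * suc l)
    θ₁≡ = trans (cast (λ r l₁ l₂ → (r ℤ.- l₁) ℤ.+ (+ m ℤ.- + 1) ℤ.* (l₂ ℤ.- (l₁ ℤ.+ + 1))))
          (trans (θ₁-poly (+ m′) (+ l))
                 (cong (λ w → + 1 ℤ.+ (+ m′ ℤ.+ w)) (sym (trans (pos-* (m′ * m′) (suc l))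
                                                                (cong (ℤ._* + suc l) (pos-* m′ m′))))))
    θ₃≡ : θ₃ (m * k) (m * l) (m′ * k) (m * l + 1) m (suc (k + k)) ≡ + suc (k + k)
    θ₃≡ = trans (cast (λ r l₁ l₂ → ((r ℤ.- l₁) ℤ.- l₂) ℤ.+ (l₁ ℤ.+ + 1))) (θ₃-poly (+ m′) (+ l))

corollary5 : (t : ℕ) → t ≥ 1 →
    Σ (Incidence (4 * t ∸ 1) (4 * t ∸ 1)) (IsSkewHadamardDesign t) →
    (m : ℕ) → m ≥ 2 →
    Σ (Incidence (m * (4 * t ∸ 1)) (m * (4 * t ∸ 1))) λ N →
      IsSelfDualRD (m * (4 * t ∸ 1)) (m * (4 * t ∸ 1))
        (m * (2 * t ∸ 1)) (m * (2 * t ∸ 1))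
        (m * (t ∸ 1)) ((m ∸ 2) * (2 * t ∸ 1)) (m * (t ∸ 1) + 1)
        m (4 * t ∸ 1) N ×
      IsSemiRegularII (m * (2 * t ∸ 1))
        (m * (t ∸ 1)) ((m ∸ 2) * (2 * t ∸ 1)) (m * (t ∸ 1) + 1)
        m (4 * t ∸ 1) ×
      IsResolvable (2 * t ∸ 1) N
corollary5 _ _ _ (suc zero) (s≤s ())
corollary5 (suc s) _ (A , design) m@(suc (suc m′)) _ =
  BlockMatrix.blockMatrix m A ,
  blockMatrix-isSelfDualRD m n≡ k≡ design ,
  semiRegularII m′ {l = s} k≡ n≡ ,
  BlockDesign.isResolvable m n≡ k≡ design
  where
  -- For t = suc s the truncated subtractions reduce to the left-hand sides of the lemmas below.
  k≡ : 2 * suc s ∸ 1 ≡ suc (s + s)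
  k≡ = lemma s
    where
    lemma : ∀ s → s + (suc s + 0) ≡ suc (s + s)
    lemma = solve-∀
  n≡ : 4 * suc s ∸ 1 ≡ suc ((2 * suc s ∸ 1) + (2 * suc s ∸ 1))
  n≡ = lemma s
    where
    lemma : ∀ s → s + (suc s + (suc s + (suc s + 0))) ≡ suc (s + (suc s + 0) + (s + (suc s + 0)))
    lemma = solve-∀
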